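{- Let $\sigma\in I^{\max}_{n,k}$ and let $\omega\in I_{n,k}$ with $\omega\le\sigma$ and $\omega\ne\sigma$. Then: (a) for every arc $(i,j)\in\omega$ and fixed point $f\in\omega^0$ with $i<f<j$, at least one of $(i,f)\omega^-_{(i,j)}$ and $(f,j)\omega^-_{(i,j)}$ is $\le\sigma$; (b) for every pair of arcs $(i,j),(l,m)\in\omega$ with $i<l<j<m$, at least one of $(i,l)(j,m)\omega^-_{(i,j),(l,m)}$ and $(i,m)(j,l)\omega^-_{(i,j),(l,m)}$ is $\le\sigma$.
   Context: $I_{n,k}$: involutions of $\{1,\dots,n\}$ with exactly $k$ disjoint 2-cycles, identified with link patterns (arcs $(a,b)$, $a<b=\sigma(a)$); $\omega^0$ = fixed points. $I^{\max}_{n,k}$: link patterns with no crossing arcs ($a<c<b<d$ for arcs $(a,b),(c,d)$) and no fixed point under an arc. $\omega^-_{\dots}$ deletes the listed arcs; $(a,b)\omega$ adds the arc $(a,b)$ between fixed points $a<b$. For $1\le a<b\le n$, $R_{[a,b]}(\sigma)$ = number of arcs of $\sigma$ with both endpoints in $[a,b]$; $\upsilon\le\sigma$ iff $R_{[a,b]}(\upsilon)\le R_{[a,b]}(\sigma)$ for all $a<b$. -}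

module Defs where

open import Data.Nat using (ℕ) renaming (_≤_ to _≤ℕ_)
open import Data.Fin using (Fin; _<_; _≤_; _≟_)
open import Data.Fin.Properties using (_<?_; _≤?_)
open import Data.Product using (_×_)
open import Relation.Nullary using (¬_; yes; no)
open import Relation.Nullary.Decidable using (_×-dec_)
open import Relation.Binary.PropositionalEquality using (_≡_)
import Data.List as L

-- A (raw) map on {1,…,n}, positions are Fin n ordered by toℕ.
Map : ℕ → Set
Map n = Fin n → Fin n

Involution : ∀ {n} → Map n → Set
Involution σ = ∀ x → σ (σ x) ≡ x

numArcs : ∀ {n} → Map n → ℕ
numArcs {n} σ = L.length (L.filter (λ x → x <? σ x) (L.allFin n))

InI : (n k : ℕ) → Map n → Set
InI n k σ = Involution σ × numArcs σ ≡ k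

R : ∀ {n} → Map n → Fin n → Fin n → ℕ
R {n} σ a b = L.length (L.filter (λ x → (a ≤? x) ×-dec ((x <? σ x) ×-dec (σ x ≤? b))) (L.allFin n))

InImax : (n k : ℕ) → Map n → Set
InImax n k σ = InI n k σ
  × (∀ a b c d → a < b → σ a ≡ b → c < d → σ c ≡ d → ¬ (a < c × c < b × b < d))
  × (∀ a b f → a < b → σ a ≡ b → σ f ≡ f → ¬ (a < f × f < b))

_≼_ : ∀ {n} → Map n → Map n → Set
υ ≼ σ = ∀ a b → a < b → R υ a b ≤ℕ R σ a b

upd : ∀ {n} → Map n → Fin n → Fin n → Map n
upd f x y z with z ≟ x
... | yes _ = y
... | no _ = f z

-- link p q ω : set p ↦ q and q ↦ p (adds arc (p,q)), other points unchanged.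
-- e.g. (i,f)ω^-_{(i,j)} = link i f (unlink1 j ω);
--      (i,l)(j,m)ω^-_{(i,j),(l,m)} = link i l (link j m ω).
link : ∀ {n} → Fin n → Fin n → Map n → Map n
link p q ω = upd (upd ω p q) q p

unlink1 : ∀ {n} → Fin n → Map n → Map n
unlink1 p ω = upd ω p p

module Submission where

-- Proposition 17: let σ ∈ I^max_{n,k} and ω ∈ I_{n,k} with ω ≼ σ.  (a) For an arc (i, j) of
-- ω and a fixed point f under it, (i,f)ω⁻ or (f,j)ω⁻ is ≼ σ.  (b) For crossing arcs (i, j),
-- (l, m) of ω, (i,l)(j,m)ω⁻ or (i,m)(j,l)ω⁻ is ≼ σ.
--
-- R counts arcs at their left end, so R τ [a,b] is a sum over the points of Fin n of
-- products of indicators.  In this form two inclusion–exclusion identities for overlapping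
-- intervals [s,u), [t,v) (s ≤ t ≤ u ≤ v) are ring identities plus one reindexing along τ.
-- They yield the straddle lemma: [s,u) and [t,v) cannot both be tight for ω ≼ σ if ω has
-- an arc from [s,t) to [u,v) and a point in [t,u) not matched inside [s,v); tightness would
-- transfer the arc to σ, and σ being non-crossing with no fixed point under an arc then
-- matches all of [t,u), so σ would have strictly more arcs than ω on one of the intervals.
--
-- Each candidate in (a) and (b) differs from ω by re-linking a few points, so it has at most
-- one arc more than ω in any interval, and more only in intervals of a specific shape.  A
-- short decision argument shows one candidate is ≼ σ unless intervals of the two shapes
-- are tight simultaneously, and in both parts such a pair straddles an arc of ω around a
-- point that ω does not match inside it, which the straddle lemma excludes.

open import Defs
open import Level using (Level)
open import Data.Nat using (ℕ; zero; suc; _+_; _*_; _≤_; _<_; z≤n; s≤s; s≤s⁻¹)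
open import Data.Nat.Properties
  using ( _≤?_; _<?_; ≤-refl; ≤-reflexive; ≤-trans; ≤-antisym; <-trans; <-irrefl; <-asym; <-cmp
        ; <-≤-trans; ≤-<-trans; <⇒≤; <⇒≱; ≤⇒≯; ≮⇒≥; ≰⇒>; ≤∧≢⇒<; 1+n≰n; n≤1+n; m≤m+n
        ; +-comm; +-assoc; +-suc; +-identityʳ; +-mono-≤; +-monoʳ-≤; +-monoˡ-<
        ; +-cancelˡ-≤; +-cancelʳ-≤; *-identityʳ; *-zeroʳ; *-mono-≤; *-monoʳ-≤
        ; +-0-commutativeMonoid; module ≤-Reasoning )
open import Data.Nat.Tactic.RingSolver using (solve-∀)
open import Data.Fin using (Fin; zero; suc; toℕ; fromℕ<; punchIn; _≟_)
  renaming (_≤_ to _≤ᶠ_; _<_ to _<ᶠ_)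
open import Data.Fin.Properties using (punchInᵢ≢i; toℕ-fromℕ<; toℕ-injective; toℕ<n; any?; <⇒≢)
  renaming (_≤?_ to _≤ᶠ?_; _<?_ to _<ᶠ?_)
open import Data.Fin.Permutation using (permutation)
open import Data.List using (tabulate; filter; length)
open import Data.Product using (_×_; _,_; ∃; proj₁; proj₂)
open import Data.Sum using (_⊎_; inj₁; inj₂; [_,_]′)
open import Data.Empty using (⊥; ⊥-elim)
open import Function using (_∘_; id)
open import Relation.Nullary using (¬_; Dec; yes; no)
open import Relation.Nullary.Decidable using (_×-dec_)
open import Relation.Unary using (Decidable)
open import Relation.Binary.Definitions using (tri<; tri≈; tri>)
open import Relation.Binary.PropositionalEquality
  using (_≡_; _≢_; refl; sym; trans; cong; cong₂; subst; subst₂; ≢-sym; module ≡-Reasoning)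
open import Algebra.Properties.CommutativeMonoid.Sum +-0-commutativeMonoid
  using (sum; sum-remove; sum-cong-≗; sum-permute; ∑-distrib-+)

private
  variable
    ℓ ℓ′ ℓ″ : Level
    P : Set ℓ
    Q : Set ℓ′
    B : Set ℓ″

𝟙 : ∀ {p} {P : Set p} → Dec P → ℕ
𝟙 (yes _) = 1
𝟙 (no _)  = 0

𝟙-yes : P → (p? : Dec P) → 𝟙 p? ≡ 1
𝟙-yes _ (yes _) = refl
𝟙-yes x (no ¬x) = ⊥-elim (¬x x)

𝟙-no : ¬ P → (p? : Dec P) → 𝟙 p? ≡ 0
𝟙-no ¬x (yes x) = ⊥-elim (¬x x)
𝟙-no _  (no _)  = refl

𝟙≤1 : (p? : Dec P) → 𝟙 p? ≤ 1
𝟙≤1 (yes _) = ≤-refl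
𝟙≤1 (no _)  = z≤n

𝟙-pos : (p? : Dec P) → 1 ≤ 𝟙 p? → P
𝟙-pos (yes x) _ = x

𝟙-⇔ : (P → Q) → (Q → P) → (p? : Dec P) (q? : Dec Q) → 𝟙 p? ≡ 𝟙 q?
𝟙-⇔ f g (yes x) q? = sym (𝟙-yes (f x) q?)
𝟙-⇔ f g (no ¬x) q? = sym (𝟙-no (λ y → ¬x (g y)) q?)

𝟙-× : (p? : Dec P) (q? : Dec Q) → 𝟙 (p? ×-dec q?) ≡ 𝟙 p? * 𝟙 q?
𝟙-× (yes _) (yes _) = refl
𝟙-× (yes _) (no _)  = refl
𝟙-× (no _)  _       = refl

𝟙³ : ∀ {R : Set ℓ″} (p? : Dec P) (q? : Dec Q) (r? : Dec R) → 𝟙 p? * (𝟙 q? * 𝟙 r?) ≡ 𝟙 (p? ×-dec (q? ×-dec r?))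
𝟙³ p? q? r? = sym (trans (𝟙-× p? (q? ×-dec r?)) (cong (𝟙 p? *_) (𝟙-× q? r?)))

𝟙-mono-or : (P → Q ⊎ B) → (p? : Dec P) (q? : Dec Q) → 𝟙 p? ≤ 𝟙 q? ⊎ B
𝟙-mono-or f (no _)  q? = inj₁ z≤n
𝟙-mono-or f (yes x) q? with f x
... | inj₁ y = inj₁ (≤-reflexive (sym (𝟙-yes y q?)))
... | inj₂ b = inj₂ b

𝟙-pair-bound : ∀ {P₁ P₂ Q₁ Q₂ : Set} → (P₁ → P₂ → Q₁ × Q₂) →
  (p₁ : Dec P₁) (p₂ : Dec P₂) (q₁ : Dec Q₁) (q₂ : Dec Q₂) → 𝟙 p₁ + 𝟙 p₂ ≤ suc (𝟙 q₁ + 𝟙 q₂)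
𝟙-pair-bound both (yes a₁) (yes a₂) q₁ q₂
  rewrite 𝟙-yes (proj₁ (both a₁ a₂)) q₁ | 𝟙-yes (proj₂ (both a₁ a₂)) q₂ = s≤s (s≤s z≤n)
𝟙-pair-bound both (yes _) (no _)  q₁ q₂ = s≤s z≤n
𝟙-pair-bound both (no _)  p₂      q₁ q₂ = ≤-trans (𝟙≤1 p₂) (s≤s z≤n)

drop-zero : ∀ a {b} → b ≡ 0 → a + b ≡ a
drop-zero a refl = +-identityʳ a

sum-mono : ∀ {n} {f g : Fin n → ℕ} → (∀ x → f x ≤ g x) → sum f ≤ sum g
sum-mono {zero}  _   = z≤n
sum-mono {suc n} f≤g = +-mono-≤ (f≤g zero) (sum-mono (f≤g ∘ suc))

sum-zero : ∀ {n} {f : Fin n → ℕ} → (∀ x → f x ≡ 0) → sum f ≡ 0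
sum-zero {zero}  _  = refl
sum-zero {suc n} f0 = cong₂ _+_ (f0 zero) (sum-zero (f0 ∘ suc))

sum-point : ∀ {n} (f : Fin n → ℕ) p → f p ≤ sum f
sum-point {suc n} f p = ≤-trans (m≤m+n (f p) _) (≤-reflexive (sym (sum-remove {i = p} f)))

sum-pos : ∀ {n} (f : Fin n → ℕ) → 1 ≤ sum f → ∃ λ x → 1 ≤ f x
sum-pos {suc n} f pos with f zero in eq
... | suc _ = zero , subst (1 ≤_) (sym eq) (s≤s z≤n)
... | zero  with sum-pos (f ∘ suc) pos
...   | x , fx = suc x , fx

sum-strict : ∀ {n} {f g : Fin n → ℕ} p → (∀ x → f x ≤ g x) → f p < g p → sum f < sum g
sum-strict {suc n} {f} {g} p f≤g fp<gp = begin-strict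
  sum f                            ≡⟨ sum-remove {i = p} f ⟩
  f p + sum (f ∘ punchIn p)        <⟨ +-monoˡ-< _ fp<gp ⟩
  g p + sum (f ∘ punchIn p)        ≤⟨ +-monoʳ-≤ (g p) (sum-mono (f≤g ∘ punchIn p)) ⟩
  g p + sum (g ∘ punchIn p)        ≡⟨ sum-remove {i = p} g ⟨
  sum g                            ∎
  where open ≤-Reasoning

sum-change : ∀ {n} {f g : Fin n → ℕ} p → (∀ x → x ≢ p → f x ≡ g x) → sum f + g p ≡ sum g + f p
sum-change {suc n} {f} {g} p agree = begin
  sum f + g p                      ≡⟨ cong (_+ g p) (sum-remove {i = p} f) ⟩
  f p + sum (f ∘ punchIn p) + g p  ≡⟨ cong (λ s → f p + s + g p) (sum-cong-≗ (λ y → agree (punchIn p y) (punchInᵢ≢i p y))) ⟩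
  f p + sum (g ∘ punchIn p) + g p  ≡⟨ swap (f p) _ (g p) ⟩
  g p + sum (g ∘ punchIn p) + f p  ≡⟨ cong (_+ f p) (sum-remove {i = p} g) ⟨
  sum g + f p                      ∎
  where
  open ≡-Reasoning
  swap : ∀ a s b → a + s + b ≡ b + s + a
  swap = solve-∀

sum-involution : ∀ {n} (τ : Map n) → Involution τ → (f : Fin n → ℕ) → sum f ≡ sum (f ∘ τ)
sum-involution τ inv f = sum-permute f (permutation τ τ inv inv)

count-filter : ∀ {a m} {A : Set a} {P : A → Set ℓ} (P? : Decidable P) (v : Fin m → A) →
  length (filter P? (tabulate v)) ≡ sum (λ x → 𝟙 (P? (v x)))
count-filter {m = zero}  P? v = refl
count-filter {m = suc m} P? v with P? (v zero)
... | yes _ = cong suc (count-filter P? (v ∘ suc))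
... | no _  = count-filter P? (v ∘ suc)

In : ℕ → ℕ → ℕ → Set
In lo hi z = lo ≤ z × z < hi

in? : ∀ lo hi z → Dec (In lo hi z)
in? lo hi z = (lo ≤? z) ×-dec (z <? hi)

⟦_,_⟫ : ℕ → ℕ → ℕ → ℕ
⟦ lo , hi ⟫ z = 𝟙 (in? lo hi z)

⟦⟫-split : ∀ {lo mid hi} → lo ≤ mid → mid ≤ hi → ∀ z → ⟦ lo , hi ⟫ z ≡ ⟦ lo , mid ⟫ z + ⟦ mid , hi ⟫ z
⟦⟫-split {lo} {mid} {hi} lo≤mid mid≤hi z = by-cases (z <? mid)
  where
  open ≡-Reasoning
  by-cases : Dec (z < mid) → ⟦ lo , hi ⟫ z ≡ ⟦ lo , mid ⟫ z + ⟦ mid , hi ⟫ z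
  by-cases (yes z<mid) = begin
    ⟦ lo , hi ⟫ z                     ≡⟨ 𝟙-⇔ (λ (l , _) → l , z<mid) (λ (l , _) → l , <-≤-trans z<mid mid≤hi) (in? lo hi z) (in? lo mid z) ⟩
    ⟦ lo , mid ⟫ z                    ≡⟨ +-identityʳ _ ⟨
    ⟦ lo , mid ⟫ z + 0                ≡⟨ cong (_ +_) (𝟙-no (λ (m≤z , _) → <⇒≱ z<mid m≤z) (in? mid hi z)) ⟨
    ⟦ lo , mid ⟫ z + ⟦ mid , hi ⟫ z   ∎
  by-cases (no z≮mid) = begin
    ⟦ lo , hi ⟫ z                     ≡⟨ 𝟙-⇔ (λ (_ , h) → ≮⇒≥ z≮mid , h) (λ (m , h) → ≤-trans lo≤mid m , h) (in? lo hi z) (in? mid hi z) ⟩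
    ⟦ mid , hi ⟫ z                    ≡⟨ cong (_+ _) (𝟙-no (λ (_ , z<m) → z≮mid z<m) (in? lo mid z)) ⟨
    ⟦ lo , mid ⟫ z + ⟦ mid , hi ⟫ z   ∎

ArcIn : ℕ → ℕ → ℕ → ℕ → Set
ArcIn lo hi X Y = X < Y × In lo hi X × In lo hi Y

arcIn : ∀ {lo hi X Y} → lo ≤ X → X < Y → Y < hi → ArcIn lo hi X Y
arcIn lo≤X X<Y Y<hi = X<Y , (lo≤X , <-trans X<Y Y<hi) , (≤-trans lo≤X (<⇒≤ X<Y) , Y<hi)

-- Its indicator, written as a product so that counting identities become ring identities.
arc : ℕ → ℕ → ℕ → ℕ → ℕ
arc lo hi X Y = 𝟙 (X <? Y) * (⟦ lo , hi ⟫ X * ⟦ lo , hi ⟫ Y)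

arcIn? : ∀ lo hi X Y → Dec (ArcIn lo hi X Y)
arcIn? lo hi X Y = (X <? Y) ×-dec (in? lo hi X ×-dec in? lo hi Y)

arc≡𝟙 : ∀ lo hi X Y → arc lo hi X Y ≡ 𝟙 (arcIn? lo hi X Y)
arc≡𝟙 lo hi X Y = 𝟙³ (X <? Y) (in? lo hi X) (in? lo hi Y)

arc-backward : ∀ lo hi {X Y} → Y ≤ X → arc lo hi X Y ≡ 0
arc-backward lo hi {X} {Y} Y≤X = cong (_* (⟦ lo , hi ⟫ X * ⟦ lo , hi ⟫ Y)) (𝟙-no (≤⇒≯ Y≤X) (X <? Y))

arc-refl : ∀ lo hi X → arc lo hi X X ≡ 0
arc-refl lo hi X = arc-backward lo hi (≤-refl {X})

arc≤1 : ∀ lo hi X Y → arc lo hi X Y ≤ 1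
arc≤1 lo hi X Y = subst (_≤ 1) (sym (arc≡𝟙 lo hi X Y)) (𝟙≤1 (arcIn? lo hi X Y))

arc-mono-or : ∀ {lo hi X Y X′ Y′} → (ArcIn lo hi X Y → ArcIn lo hi X′ Y′ ⊎ B) →
  arc lo hi X Y ≤ arc lo hi X′ Y′ ⊎ B
arc-mono-or {lo = lo} {hi} {X} {Y} {X′} {Y′} f =
  subst₂ (λ l r → l ≤ r ⊎ _) (sym (arc≡𝟙 lo hi X Y)) (sym (arc≡𝟙 lo hi X′ Y′))
    (𝟙-mono-or f (arcIn? lo hi X Y) (arcIn? lo hi X′ Y′))

arc-pair-bound : ∀ {lo hi X₁ Y₁ X₂ Y₂ X₃ Y₃ X₄ Y₄} →
  (ArcIn lo hi X₁ Y₁ → ArcIn lo hi X₂ Y₂ → ArcIn lo hi X₃ Y₃ × ArcIn lo hi X₄ Y₄) →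
  arc lo hi X₁ Y₁ + arc lo hi X₂ Y₂ ≤ suc (arc lo hi X₃ Y₃ + arc lo hi X₄ Y₄)
arc-pair-bound {lo} {hi} {X₁} {Y₁} {X₂} {Y₂} {X₃} {Y₃} {X₄} {Y₄} both =
  subst₂ (λ l r → l ≤ suc r)
    (sym (cong₂ _+_ (arc≡𝟙 lo hi X₁ Y₁) (arc≡𝟙 lo hi X₂ Y₂)))
    (sym (cong₂ _+_ (arc≡𝟙 lo hi X₃ Y₃) (arc≡𝟙 lo hi X₄ Y₄)))
    (𝟙-pair-bound both (arcIn? lo hi X₁ Y₁) (arcIn? lo hi X₂ Y₂) (arcIn? lo hi X₃ Y₃) (arcIn? lo hi X₄ Y₄))

arcs : ∀ {n} → Map n → ℕ → ℕ → ℕ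
arcs τ lo hi = sum λ x → arc lo hi (toℕ x) (toℕ (τ x))

R≡arcs : ∀ {n} (τ : Map n) a b → R τ a b ≡ arcs τ (toℕ a) (suc (toℕ b))
R≡arcs {n} τ a b = trans (count-filter arcAt? id) (sum-cong-≗ pointwise)
  where
  arcAt? : ∀ x → Dec (a ≤ᶠ x × x <ᶠ τ x × τ x ≤ᶠ b)
  arcAt? x = (a ≤ᶠ? x) ×-dec ((x <ᶠ? τ x) ×-dec (τ x ≤ᶠ? b))
  pointwise : ∀ x → 𝟙 (arcAt? x) ≡ arc (toℕ a) (suc (toℕ b)) (toℕ x) (toℕ (τ x))
  pointwise x = trans
    (𝟙-⇔ (λ (a≤x , x<y , y≤b) → arcIn a≤x x<y (s≤s y≤b))
          (λ (x<y , (a≤x , _) , (_ , y<b+1)) → a≤x , x<y , s≤s⁻¹ y<b+1) (arcAt? x) _)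
    (sym (arc≡𝟙 (toℕ a) (suc (toℕ b)) (toℕ x) (toℕ (τ x))))

arcs-short : ∀ {n} (τ : Map n) {lo hi} → hi ≤ suc lo → arcs τ lo hi ≡ 0
arcs-short τ {lo} {hi} hi≤1+lo = sum-zero λ x →
  trans (arc≡𝟙 lo hi (toℕ x) (toℕ (τ x))) (𝟙-no no-arc (arcIn? lo hi (toℕ x) (toℕ (τ x))))
  where
  no-arc : ∀ {X Y} → ¬ ArcIn lo hi X Y
  no-arc (X<Y , (lo≤X , _) , (_ , Y<hi)) =
    1+n≰n (≤-trans (s≤s (≤-trans (s≤s lo≤X) X<Y)) (≤-trans Y<hi hi≤1+lo))

arcs-≼ : ∀ {n} {υ σ : Map n} → υ ≼ σ → ∀ lo {hi} → hi ≤ n → arcs υ lo hi ≤ arcs σ lo hi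
arcs-≼ {υ = υ} {σ} υ≼σ lo {zero}  _ = subst (_≤ _) (sym (arcs-short υ {lo} z≤n)) z≤n
arcs-≼ {υ = υ} {σ} υ≼σ lo {suc h} h<n with lo <? h
... | no lo≮h = subst (_≤ _) (sym (arcs-short υ {lo} (s≤s (≮⇒≥ lo≮h)))) z≤n
... | yes lo<h = subst₂ (λ l r → arcs υ l (suc r) ≤ arcs σ l (suc r)) (toℕ-fromℕ< lo<n) (toℕ-fromℕ< h<n)
      (subst₂ _≤_ (R≡arcs υ a b) (R≡arcs σ a b) (υ≼σ a b a<b))
  where
  lo<n = <-trans lo<h h<n
  a = fromℕ< lo<n
  b = fromℕ< h<n
  a<b : a <ᶠ b
  a<b = subst₂ _<_ (sym (toℕ-fromℕ< lo<n)) (sym (toℕ-fromℕ< h<n)) lo<h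

crossing : ∀ {n} → Map n → ℕ → ℕ → ℕ → ℕ → Fin n → ℕ
crossing τ s t u v x = 𝟙 (toℕ x <? toℕ (τ x)) * (⟦ s , t ⟫ (toℕ x) * ⟦ u , v ⟫ (toℕ (τ x)))

crossing-dec : ∀ {n} (τ : Map n) s t u v x →
  Dec (toℕ x < toℕ (τ x) × In s t (toℕ x) × In u v (toℕ (τ x)))
crossing-dec τ s t u v x = (toℕ x <? toℕ (τ x)) ×-dec (in? s t (toℕ x) ×-dec in? u v (toℕ (τ x)))

crossing≡𝟙 : ∀ {n} (τ : Map n) {s t u v} x → crossing τ s t u v x ≡ 𝟙 (crossing-dec τ s t u v x)
crossing≡𝟙 τ {s} {t} {u} {v} x = 𝟙³ (toℕ x <? toℕ (τ x)) (in? s t (toℕ x)) (in? u v (toℕ (τ x)))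

crossing-pos : ∀ {n} (τ : Map n) {s t u v} x → 1 ≤ crossing τ s t u v x →
  toℕ x < toℕ (τ x) × In s t (toℕ x) × In u v (toℕ (τ x))
crossing-pos τ x pos = 𝟙-pos (crossing-dec τ _ _ _ _ x) (subst (1 ≤_) (crossing≡𝟙 τ x) pos)

crossing-at : ∀ {n} (τ : Map n) {s t u v} x →
  toℕ x < toℕ (τ x) → In s t (toℕ x) → In u v (toℕ (τ x)) → 1 ≤ crossing τ s t u v x
crossing-at τ x x<τx in₁ in₂ =
  ≤-reflexive (sym (trans (crossing≡𝟙 τ x) (𝟙-yes (x<τx , in₁ , in₂) (crossing-dec τ _ _ _ _ x))))

crossing-identity : ∀ {n} (τ : Map n) {s t u v} → s ≤ t → t ≤ u → u ≤ v →
  arcs τ s v + arcs τ t u ≡ arcs τ s u + arcs τ t v + sum (crossing τ s t u v)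
crossing-identity τ {s} {t} {u} {v} s≤t t≤u u≤v = begin
  arcs τ s v + arcs τ t u
    ≡⟨ ∑-distrib-+ (summand s v) (summand t u) ⟨
  sum (λ x → summand s v x + summand t u x)
    ≡⟨ sum-cong-≗ (λ x → pointwise (toℕ x) (toℕ (τ x))) ⟩
  sum (λ x → summand s u x + summand t v x + crossing τ s t u v x)
    ≡⟨ ∑-distrib-+ (λ x → summand s u x + summand t v x) (crossing τ s t u v) ⟩
  sum (λ x → summand s u x + summand t v x) + sum (crossing τ s t u v)
    ≡⟨ cong (_+ sum (crossing τ s t u v)) (∑-distrib-+ (summand s u) (summand t v)) ⟩
  arcs τ s u + arcs τ t v + sum (crossing τ s t u v) ∎
  where
  open ≡-Reasoning
  summand : ℕ → ℕ → _ → ℕ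
  summand lo hi x = arc lo hi (toℕ x) (toℕ (τ x))
  poly : ∀ c p q w p′ q′ w′ →
    c * ((p + (q + w)) * (p′ + (q′ + w′))) + c * (q * q′)
      ≡ c * ((p + q) * (p′ + q′)) + c * ((q + w) * (q′ + w′)) + c * (p * w′) + c * (w * p′)
  poly = solve-∀
  no-backward-crossing : ∀ X Y → 𝟙 (X <? Y) * (⟦ u , v ⟫ X * ⟦ s , t ⟫ Y) ≡ 0
  no-backward-crossing X Y = trans (𝟙³ (X <? Y) (in? u v X) (in? s t Y))
    (𝟙-no (λ (X<Y , (u≤X , _) , (_ , Y<t)) → <-asym X<Y (<-≤-trans Y<t (≤-trans t≤u u≤X))) _)
  pointwise : ∀ X Y → arc s v X Y + arc t u X Y ≡ arc s u X Y + arc t v X Y + 𝟙 (X <? Y) * (⟦ s , t ⟫ X * ⟦ u , v ⟫ Y)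
  pointwise X Y
    rewrite ⟦⟫-split s≤t (≤-trans t≤u u≤v) X | ⟦⟫-split s≤t (≤-trans t≤u u≤v) Y
          | ⟦⟫-split t≤u u≤v X | ⟦⟫-split t≤u u≤v Y
          | ⟦⟫-split s≤t t≤u X | ⟦⟫-split s≤t t≤u Y
    = trans (poly (𝟙 (X <? Y)) (⟦ s , t ⟫ X) (⟦ t , u ⟫ X) (⟦ u , v ⟫ X) (⟦ s , t ⟫ Y) (⟦ t , u ⟫ Y) (⟦ u , v ⟫ Y))
            (drop-zero _ (no-backward-crossing X Y))

apart : ℕ → ℕ → ℕ
apart X Y = 𝟙 (X <? Y) + 𝟙 (Y <? X)

apart≤1 : ∀ X Y → apart X Y ≤ 1
apart≤1 X Y with X <? Y
... | yes X<Y = ≤-reflexive (cong suc (𝟙-no (<-asym X<Y) (Y <? X)))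
... | no _    = 𝟙≤1 (Y <? X)

apart-refl : ∀ X → apart X X ≡ 0
apart-refl X = cong₂ _+_ (𝟙-no (<-irrefl refl) (X <? X)) (𝟙-no (<-irrefl refl) (X <? X))

apart-≢ : ∀ {X Y} → X ≢ Y → apart X Y ≡ 1
apart-≢ {X} {Y} X≢Y with <-cmp X Y
... | tri< X<Y _ _ = cong₂ _+_ (𝟙-yes X<Y (X <? Y)) (𝟙-no (<-asym X<Y) (Y <? X))
... | tri≈ _ X≡Y _ = ⊥-elim (X≢Y X≡Y)
... | tri> _ _ Y<X = cong₂ _+_ (𝟙-no (<-asym Y<X) (X <? Y)) (𝟙-yes Y<X (Y <? X))

matched : ∀ {n} → Map n → ℕ → ℕ → ℕ → ℕ → Fin n → ℕ
matched τ s t u v x = ⟦ t , u ⟫ (toℕ x) * (apart (toℕ x) (toℕ (τ x)) * ⟦ s , v ⟫ (toℕ (τ x)))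

-- For an involution τ, an arc (x, τ x) with x < τ x can equally be counted at its right
-- end τ x, where it appears as the pair (τ x, x) with τ x > x.
count-at-right-end : ∀ {n} (τ : Map n) → Involution τ → (g h : ℕ → ℕ) →
  sum (λ x → 𝟙 (toℕ x <? toℕ (τ x)) * (g (toℕ x) * h (toℕ (τ x))))
    ≡ sum (λ x → 𝟙 (toℕ (τ x) <? toℕ x) * (g (toℕ (τ x)) * h (toℕ x)))
count-at-right-end τ inv g h = trans (sum-involution τ inv _) (sum-cong-≗ λ x →
  cong (λ z → 𝟙 (toℕ (τ x) <? toℕ z) * (g (toℕ (τ x)) * h (toℕ z))) (inv x))

-- Inclusion–exclusion for the overlapping intervals [s,u) and [t,v): besides the arcs of
-- [s,t) and [u,v) they contain, counted with multiplicity, one arc end for every point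
-- of the overlap [t,u) that τ matches inside [s,v).
overlap-identity : ∀ {n} (τ : Map n) → Involution τ → ∀ {s t u v} → s ≤ t → t ≤ u → u ≤ v →
  arcs τ s u + arcs τ t v ≡ arcs τ s t + arcs τ u v + sum (matched τ s t u v)
overlap-identity τ inv {s} {t} {u} {v} s≤t t≤u u≤v = begin
  arcs τ s u + arcs τ t v
    ≡⟨ ∑-distrib-+ (summand s u) (summand t v) ⟨
  sum (λ x → summand s u x + summand t v x)
    ≡⟨ sum-cong-≗ (λ x → pointwise (toℕ x) (toℕ (τ x))) ⟩
  sum (λ x → summand s t x + summand u v x + (left-end x + right-end x))
    ≡⟨ ∑-distrib-+ (λ x → summand s t x + summand u v x) (λ x → left-end x + right-end x) ⟩
  sum (λ x → summand s t x + summand u v x) + sum (λ x → left-end x + right-end x)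
    ≡⟨ cong₂ _+_ (∑-distrib-+ (summand s t) (summand u v)) (∑-distrib-+ left-end right-end) ⟩
  arcs τ s t + arcs τ u v + (sum left-end + sum right-end)
    ≡⟨ cong (λ r → arcs τ s t + arcs τ u v + (sum left-end + r)) (count-at-right-end τ inv ⟦ s , v ⟫ ⟦ t , u ⟫) ⟩
  arcs τ s t + arcs τ u v + (sum left-end + sum right-end-at-partner)
    ≡⟨ cong (arcs τ s t + arcs τ u v +_) (∑-distrib-+ left-end right-end-at-partner) ⟨
  arcs τ s t + arcs τ u v + sum (λ x → left-end x + right-end-at-partner x)
    ≡⟨ cong (arcs τ s t + arcs τ u v +_) (sum-cong-≗ λ x →
         collect (𝟙 (toℕ x <? toℕ (τ x))) (𝟙 (toℕ (τ x) <? toℕ x)) (⟦ t , u ⟫ (toℕ x)) (⟦ s , v ⟫ (toℕ (τ x)))) ⟩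
  arcs τ s t + arcs τ u v + sum (matched τ s t u v) ∎
  where
  open ≡-Reasoning
  summand : ℕ → ℕ → _ → ℕ
  summand lo hi x = arc lo hi (toℕ x) (toℕ (τ x))
  left-end right-end right-end-at-partner : Fin _ → ℕ
  left-end x = 𝟙 (toℕ x <? toℕ (τ x)) * (⟦ t , u ⟫ (toℕ x) * ⟦ s , v ⟫ (toℕ (τ x)))
  right-end x = 𝟙 (toℕ x <? toℕ (τ x)) * (⟦ s , v ⟫ (toℕ x) * ⟦ t , u ⟫ (toℕ (τ x)))
  right-end-at-partner x = 𝟙 (toℕ (τ x) <? toℕ x) * (⟦ s , v ⟫ (toℕ (τ x)) * ⟦ t , u ⟫ (toℕ x))
  poly : ∀ c p q w p′ q′ w′ →
    c * ((p + q) * (p′ + q′)) + c * ((q + w) * (q′ + w′))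
      ≡ c * (p * p′) + c * (w * w′) + (c * (q * (p′ + (q′ + w′))) + c * ((p + (q + w)) * q′))
  poly = solve-∀
  pointwise : ∀ X Y → arc s u X Y + arc t v X Y
    ≡ arc s t X Y + arc u v X Y + (𝟙 (X <? Y) * (⟦ t , u ⟫ X * ⟦ s , v ⟫ Y) + 𝟙 (X <? Y) * (⟦ s , v ⟫ X * ⟦ t , u ⟫ Y))
  pointwise X Y
    rewrite ⟦⟫-split s≤t (≤-trans t≤u u≤v) X | ⟦⟫-split s≤t (≤-trans t≤u u≤v) Y
          | ⟦⟫-split t≤u u≤v X | ⟦⟫-split t≤u u≤v Y
          | ⟦⟫-split s≤t t≤u X | ⟦⟫-split s≤t t≤u Y
    = poly (𝟙 (X <? Y)) (⟦ s , t ⟫ X) (⟦ t , u ⟫ X) (⟦ u , v ⟫ X) (⟦ s , t ⟫ Y) (⟦ t , u ⟫ Y) (⟦ u , v ⟫ Y)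
  collect : ∀ c d q i → c * (q * i) + d * (i * q) ≡ q * ((c + d) * i)
  collect = solve-∀

matched≤overlap : ∀ {n} (τ : Map n) s t u v x → matched τ s t u v x ≤ ⟦ t , u ⟫ (toℕ x)
matched≤overlap τ s t u v x =
  ≤-trans (*-monoʳ-≤ (⟦ t , u ⟫ (toℕ x)) (*-mono-≤ (apart≤1 (toℕ x) (toℕ (τ x))) (𝟙≤1 (in? s v (toℕ (τ x))))))
          (≤-reflexive (*-identityʳ (⟦ t , u ⟫ (toℕ x))))

Unmatched : ∀ {n} → Map n → ℕ → ℕ → Fin n → Set
Unmatched τ s v p = τ p ≡ p ⊎ toℕ (τ p) < s ⊎ v ≤ toℕ (τ p)

unmatched-point : ∀ {n} (τ : Map n) s t u v p → Unmatched τ s v p →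
  matched τ s t u v p ≡ 0
unmatched-point τ s t u v p (inj₁ fixed) = begin
  ⟦ t , u ⟫ p′ * (apart p′ (toℕ (τ p)) * ⟦ s , v ⟫ (toℕ (τ p)))
    ≡⟨ cong (λ z → ⟦ t , u ⟫ p′ * (apart p′ (toℕ z) * ⟦ s , v ⟫ (toℕ z))) fixed ⟩
  ⟦ t , u ⟫ p′ * (apart p′ p′ * ⟦ s , v ⟫ p′)
    ≡⟨ cong (λ a → ⟦ t , u ⟫ p′ * (a * ⟦ s , v ⟫ p′)) (apart-refl p′) ⟩
  ⟦ t , u ⟫ p′ * 0
    ≡⟨ *-zeroʳ (⟦ t , u ⟫ p′) ⟩
  0 ∎
  where
  open ≡-Reasoning
  p′ = toℕ p
unmatched-point τ s t u v p (inj₂ outside) = trans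
  (cong (λ i → ⟦ t , u ⟫ (toℕ p) * (apart (toℕ p) (toℕ (τ p)) * i)) (𝟙-no not-in (in? s v (toℕ (τ p)))))
  (trans (cong (⟦ t , u ⟫ (toℕ p) *_) (*-zeroʳ (apart (toℕ p) (toℕ (τ p))))) (*-zeroʳ (⟦ t , u ⟫ (toℕ p))))
  where
  not-in : ¬ In s v (toℕ (τ p))
  not-in (s≤q , q<v) = [ (λ q<s → <⇒≱ q<s s≤q) , (λ v≤q → <⇒≱ q<v v≤q) ]′ outside

NonCrossing : ∀ {n} → Map n → Set
NonCrossing σ = ∀ a b c d → a <ᶠ b → σ a ≡ b → c <ᶠ d → σ c ≡ d → ¬ (a <ᶠ c × c <ᶠ b × b <ᶠ d)

NoFixedUnderArc : ∀ {n} → Map n → Set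
NoFixedUnderArc σ = ∀ a b f → a <ᶠ b → σ a ≡ b → σ f ≡ f → ¬ (a <ᶠ f × f <ᶠ b)

-- If σ ∈ I^max has an arc from [s,t) to [u,v), every point of [t,u) lies under that arc,
-- so it is not fixed and (arcs being non-crossing) its partner lies in [s,v).
overlap-fully-matched : ∀ {n} {σ : Map n} → Involution σ → NonCrossing σ → NoFixedUnderArc σ →
  ∀ {s t u v} y → 1 ≤ crossing σ s t u v y → ∀ x → ⟦ t , u ⟫ (toℕ x) ≤ matched σ s t u v x
overlap-fully-matched {σ = σ} inv nc nf {s} {t} {u} {v} y cross x
  with crossing-pos σ y cross | in? t u (toℕ x)
... | _ | no _ = z≤n
... | y<σy , (s≤y , y<t) , (u≤σy , σy<v) | yes (t≤x , x<u) = ≤-reflexive (sym (begin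
  1 * (apart X Y * ⟦ s , v ⟫ Y)  ≡⟨ cong₂ (λ a i → 1 * (a * i)) (apart-≢ X≢Y) (𝟙-yes partner-in-range (in? s v Y)) ⟩
  1 * (1 * 1)                    ≡⟨⟩
  1                              ∎))
  where
  open ≡-Reasoning
  X = toℕ x
  Y = toℕ (σ x)
  y<x : y <ᶠ x
  y<x = <-≤-trans y<t t≤x
  x<σy : x <ᶠ σ y
  x<σy = <-≤-trans x<u u≤σy
  X≢Y : X ≢ Y
  X≢Y X≡Y = nf y (σ y) x y<σy refl (toℕ-injective (sym X≡Y)) (y<x , x<σy)
  partner-in-range : In s v Y
  partner-in-range with <-cmp X Y
  ... | tri< X<Y _ _ = ≤-trans s≤y (<⇒≤ (<-trans y<x X<Y)) ,
        ≰⇒> (λ v≤Y → nc y (σ y) x (σ x) y<σy refl X<Y refl (y<x , x<σy , <-≤-trans σy<v v≤Y))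
  ... | tri≈ _ X≡Y _ = ⊥-elim (X≢Y X≡Y)
  ... | tri> _ _ Y<X = ≮⇒≥ (λ Y<s → nc (σ x) x y (σ y) Y<X (inv x) y<σy refl (<-≤-trans Y<s s≤y , y<x , x<σy)) ,
        <-trans Y<X (<-trans x<u (≤-<-trans u≤σy σy<v))

module Straddle {n} {σ ω : Map n} (invσ : Involution σ) (invω : Involution ω)
  (non-crossing : NonCrossing σ) (no-fixed-under : NoFixedUnderArc σ) (ω≼σ : ω ≼ σ) where

  -- Tightness on [s,u) and [t,v) transfers an arc of ω from [s,t) to [u,v) to one of σ,
  -- by the crossing identity and ω ≼ σ on [s,v) and [t,u).
  crossing-transfers : ∀ {s t u v} → s ≤ t → t ≤ u → u ≤ v → v ≤ n →
    ∀ x → 1 ≤ crossing ω s t u v x → arcs ω s u ≡ arcs σ s u → arcs ω t v ≡ arcs σ t v →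
    ∃ λ y → 1 ≤ crossing σ s t u v y
  crossing-transfers {s} {t} {u} {v} s≤t t≤u u≤v v≤n x cross tight₁ tight₂ =
    sum-pos (crossing σ s t u v) (+-cancelˡ-≤ (arcs σ s u + arcs σ t v) 1 _ (begin
      arcs σ s u + arcs σ t v + 1              ≡⟨ cong₂ (λ a b → a + b + 1) tight₁ tight₂ ⟨
      arcs ω s u + arcs ω t v + 1              ≤⟨ +-monoʳ-≤ _ (≤-trans cross (sum-point (crossing ω s t u v) x)) ⟩
      arcs ω s u + arcs ω t v + sum (crossing ω s t u v)
                                               ≡⟨ crossing-identity ω s≤t t≤u u≤v ⟨
      arcs ω s v + arcs ω t u                  ≤⟨ +-mono-≤ (arcs-≼ ω≼σ s v≤n) (arcs-≼ ω≼σ t (≤-trans u≤v v≤n)) ⟩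
      arcs σ s v + arcs σ t u                  ≡⟨ crossing-identity σ s≤t t≤u u≤v ⟩
      arcs σ s u + arcs σ t v + sum (crossing σ s t u v) ∎))
    where open ≤-Reasoning

  -- Two overlapping intervals [s,u) and [t,v) cannot both be tight if ω has an arc from
  -- [s,t) to [u,v) and a point of the overlap [t,u) that it does not match inside [s,v):
  -- σ then has such an arc too, matches all of [t,u), and the overlap identity for σ
  -- exceeds that for ω by at least one.
  straddle : ∀ {s t u v} → s ≤ t → t ≤ u → u ≤ v → v ≤ n →
    ∀ x → 1 ≤ crossing ω s t u v x → ∀ p → In t u (toℕ p) → Unmatched ω s v p →
    arcs ω s u ≡ arcs σ s u → arcs ω t v ≡ arcs σ t v → ⊥
  straddle {s} {t} {u} {v} s≤t t≤u u≤v v≤n x cross p p-in p-unmatched tight₁ tight₂ = 1+n≰n (begin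
    suc (arcs σ s u + arcs σ t v)                          ≡⟨ cong₂ (λ a b → suc (a + b)) tight₁ tight₂ ⟨
    suc (arcs ω s u + arcs ω t v)                          ≡⟨ cong suc (overlap-identity ω invω s≤t t≤u u≤v) ⟩
    suc (arcs ω s t + arcs ω u v + sum (matched ω s t u v)) ≡⟨ +-suc _ _ ⟨
    arcs ω s t + arcs ω u v + suc (sum (matched ω s t u v))
      ≤⟨ +-mono-≤ (+-mono-≤ (arcs-≼ ω≼σ s (≤-trans t≤u u≤n)) (arcs-≼ ω≼σ u v≤n)) ω-falls-short ⟩
    arcs σ s t + arcs σ u v + sum in-overlap
      ≤⟨ +-monoʳ-≤ _ (sum-mono (overlap-fully-matched invσ non-crossing no-fixed-under y σ-cross)) ⟩
    arcs σ s t + arcs σ u v + sum (matched σ s t u v)     ≡⟨ overlap-identity σ invσ s≤t t≤u u≤v ⟨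
    arcs σ s u + arcs σ t v                                ∎)
    where
    open ≤-Reasoning
    u≤n = ≤-trans u≤v v≤n
    in-overlap : Fin n → ℕ
    in-overlap x = ⟦ t , u ⟫ (toℕ x)
    σ-arc = crossing-transfers s≤t t≤u u≤v v≤n x cross tight₁ tight₂
    y = proj₁ σ-arc
    σ-cross = proj₂ σ-arc
    ω-falls-short : sum (matched ω s t u v) < sum in-overlap
    ω-falls-short = sum-strict p (matched≤overlap ω s t u v)
      (subst₂ _<_ (sym (unmatched-point ω s t u v p p-unmatched)) (sym (𝟙-yes p-in (in? t u (toℕ p)))) (s≤s z≤n))

  no-tight-straddle : ∀ a c b d x y p → ω x ≡ y → a ≤ᶠ x → x <ᶠ c → c ≤ᶠ p → p ≤ᶠ b → b <ᶠ y → y ≤ᶠ d →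
    Unmatched ω (toℕ a) (suc (toℕ d)) p → R ω a b ≡ R σ a b → R ω c d ≡ R σ c d → ⊥
  no-tight-straddle a c b d x .(ω x) p refl a≤x x<c c≤p p≤b b<y y≤d unmatched tight₁ tight₂ =
    straddle s≤t t≤u u≤v (toℕ<n d)
      x (crossing-at ω x x<y (a≤x , x<c) (b<y , s≤s y≤d))
      p (c≤p , s≤s p≤b) unmatched
      (as-arcs a b tight₁) (as-arcs c d tight₂)
    where
    s≤t = ≤-trans a≤x (<⇒≤ x<c)
    t≤u = ≤-trans c≤p (≤-trans p≤b (n≤1+n _))
    u≤v = s≤s (<⇒≤ (<-≤-trans b<y y≤d))
    x<y = <-trans x<c (≤-<-trans (≤-trans c≤p p≤b) b<y)
    as-arcs : ∀ a b → R ω a b ≡ R σ a b → arcs ω (toℕ a) (suc (toℕ b)) ≡ arcs σ (toℕ a) (suc (toℕ b))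
    as-arcs a b tight = trans (sym (R≡arcs ω a b)) (trans tight (R≡arcs σ a b))

upd-here : ∀ {n} (τ : Map n) p y → upd τ p y p ≡ y
upd-here τ p y with p ≟ p
... | yes _   = refl
... | no p≢p = ⊥-elim (p≢p refl)

upd-there : ∀ {n} (τ : Map n) p y {z} → z ≢ p → upd τ p y z ≡ τ z
upd-there τ p y {z} z≢p with z ≟ p
... | yes z≡p = ⊥-elim (z≢p z≡p)
... | no _    = refl

link-there : ∀ {n} (τ : Map n) {p q z} → z ≢ p → z ≢ q → link p q τ z ≡ τ z
link-there τ {p} {q} z≢p z≢q = trans (upd-there (upd τ p q) q p z≢q) (upd-there τ p q z≢p)

arcs-upd : ∀ {n} (τ : Map n) {p p′} → τ p ≡ p′ → ∀ y lo hi →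
  arcs (upd τ p y) lo hi + arc lo hi (toℕ p) (toℕ p′) ≡ arcs τ lo hi + arc lo hi (toℕ p) (toℕ y)
arcs-upd τ {p} refl y lo hi =
  subst (λ z → arcs (upd τ p y) lo hi + arc lo hi (toℕ p) (toℕ (τ p)) ≡ arcs τ lo hi + arc lo hi (toℕ p) (toℕ z))
    (upd-here τ p y)
    (sum-change p (λ x x≢p → cong (λ z → arc lo hi (toℕ x) (toℕ z)) (upd-there τ p y x≢p)))

arcs-link : ∀ {n} (τ : Map n) {p q p′ q′} → p ≢ q → τ p ≡ p′ → τ q ≡ q′ → ∀ lo hi →
  arcs (link p q τ) lo hi + (arc lo hi (toℕ p) (toℕ p′) + arc lo hi (toℕ q) (toℕ q′))
    ≡ arcs τ lo hi + (arc lo hi (toℕ p) (toℕ q) + arc lo hi (toℕ q) (toℕ p))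
arcs-link τ {p} {q} {p′} {q′} p≢q τp τq lo hi = begin
  arcs (link p q τ) lo hi + (old-p + old-q)  ≡⟨ swap (arcs (link p q τ) lo hi) old-p old-q ⟩
  arcs (link p q τ) lo hi + old-q + old-p    ≡⟨ cong (_+ old-p) (arcs-upd (upd τ p q) (trans (upd-there τ p q (≢-sym p≢q)) τq) p lo hi) ⟩
  arcs (upd τ p q) lo hi + new-q + old-p     ≡⟨ swap′ (arcs (upd τ p q) lo hi) new-q old-p ⟩
  arcs (upd τ p q) lo hi + old-p + new-q     ≡⟨ cong (_+ new-q) (arcs-upd τ τp q lo hi) ⟩
  arcs τ lo hi + new-p + new-q               ≡⟨ +-assoc (arcs τ lo hi) new-p new-q ⟩
  arcs τ lo hi + (new-p + new-q)             ∎
  where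
  open ≡-Reasoning
  old-p = arc lo hi (toℕ p) (toℕ p′)
  old-q = arc lo hi (toℕ q) (toℕ q′)
  new-p = arc lo hi (toℕ p) (toℕ q)
  new-q = arc lo hi (toℕ q) (toℕ p)
  swap : ∀ a b c → a + (b + c) ≡ a + c + b
  swap = solve-∀
  swap′ : ∀ a b c → a + b + c ≡ a + c + b
  swap′ = solve-∀

_Exceeds_OnlyOn_ : ∀ {n} → Map n → Map n → (Fin n → Fin n → Set) → Set
ω′ Exceeds ω OnlyOn Bad = ∀ a b → R ω′ a b ≤ R ω a b ⊎ (Bad a b × R ω′ a b ≤ suc (R ω a b))

-- If ω ≼ σ, and an interval where ω₁ exceeds ω and one where ω₂ exceeds ω are never both
-- tight for ω, then ω₁ ≼ σ or ω₂ ≼ σ: a violation of ω₁ ≼ σ exhibits a tight interval of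
-- the first kind, and then ω has slack on every interval of the second kind.
one-of-two : ∀ {n} {σ ω ω₁ ω₂ : Map n} {Bad₁ Bad₂ : Fin n → Fin n → Set} → ω ≼ σ →
  ω₁ Exceeds ω OnlyOn Bad₁ → ω₂ Exceeds ω OnlyOn Bad₂ →
  (∀ {a b c d} → Bad₁ a b → Bad₂ c d → R ω a b ≡ R σ a b → R ω c d ≡ R σ c d → ⊥) →
  ω₁ ≼ σ ⊎ ω₂ ≼ σ
one-of-two {σ = σ} {ω} {ω₁} {ω₂} {Bad₁} ω≼σ exceeds₁ exceeds₂ exclusive
  with any? (λ a → any? (λ b → (a <ᶠ? b) ×-dec (R σ a b <? R ω₁ a b)))
... | no none = inj₁ λ a b a<b → ≮⇒≥ λ σ<ω₁ → none (a , b , a<b , σ<ω₁)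
... | yes (a , b , a<b , σ<ω₁) = inj₂ ω₂≼σ
  where
  bad-and-tight : Bad₁ a b × R ω a b ≡ R σ a b
  bad-and-tight with exceeds₁ a b
  ... | inj₁ ω₁≤ω = ⊥-elim (<⇒≱ σ<ω₁ (≤-trans ω₁≤ω (ω≼σ a b a<b)))
  ... | inj₂ (bad , ω₁≤1+ω) = bad , ≤-antisym (ω≼σ a b a<b) (s≤s⁻¹ (≤-trans σ<ω₁ ω₁≤1+ω))
  ω₂≼σ : ω₂ ≼ σ
  ω₂≼σ c d c<d with exceeds₂ c d
  ... | inj₁ ω₂≤ω = ≤-trans ω₂≤ω (ω≼σ c d c<d)
  ... | inj₂ (bad₂ , ω₂≤1+ω) = ≤-trans ω₂≤1+ω
        (≤∧≢⇒< (ω≼σ c d c<d) (exclusive (proj₁ bad-and-tight) bad₂ (proj₂ bad-and-tight)))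

exceeds-by : ∀ {x y old new} {B : Set} → x + old ≡ y + new → new ≤ suc old → new ≤ old ⊎ B →
  x ≤ y ⊎ (B × x ≤ suc y)
exceeds-by {x} {y} {old} {new} balance _ (inj₁ new≤old) = inj₁ (+-cancelʳ-≤ old x y (begin
  x + old  ≡⟨ balance ⟩
  y + new  ≤⟨ +-monoʳ-≤ y new≤old ⟩
  y + old  ∎))
  where open ≤-Reasoning
exceeds-by {x} {y} {old} {new} balance new≤1+old (inj₂ b) = inj₂ (b , +-cancelʳ-≤ old x (suc y) (begin
  x + old      ≡⟨ balance ⟩
  y + new      ≤⟨ +-monoʳ-≤ y new≤1+old ⟩
  y + suc old  ≡⟨ +-suc y old ⟩
  suc y + old  ∎))
  where open ≤-Reasoning

exceeds-from-arcs : ∀ {n} {ω′ ω : Map n} {Bad : Fin n → Fin n → Set} {old new : ℕ → ℕ → ℕ} →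
  (∀ lo hi → arcs ω′ lo hi + old lo hi ≡ arcs ω lo hi + new lo hi) →
  (∀ a b → new (toℕ a) (suc (toℕ b)) ≤ suc (old (toℕ a) (suc (toℕ b)))) →
  (∀ a b → new (toℕ a) (suc (toℕ b)) ≤ old (toℕ a) (suc (toℕ b)) ⊎ Bad a b) →
  ω′ Exceeds ω OnlyOn Bad
exceeds-from-arcs {ω′ = ω′} {ω} balance at-most-one only-bad a b =
  exceeds-by (subst₂ (λ r r′ → r + _ ≡ r′ + _) (sym (R≡arcs ω′ a b)) (sym (R≡arcs ω a b)) (balance _ _))
    (at-most-one a b) (only-bad a b)

+-mono-or : ∀ {a b c d} {B : Set} → a ≤ c ⊎ B → b ≤ d ⊎ B → a + b ≤ c + d ⊎ B
+-mono-or (inj₁ a≤c) (inj₁ b≤d) = inj₁ (+-mono-≤ a≤c b≤d)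
+-mono-or (inj₂ bad) _          = inj₂ bad
+-mono-or _          (inj₂ bad) = inj₂ bad

partner : ∀ {n} {τ : Map n} → Involution τ → ∀ {p q} → τ p ≡ q → τ q ≡ p
partner {τ = τ} inv {p} τp = trans (cong τ (sym τp)) (inv p)

-- Part (a): ω has an arc (i, j) and a fixed point f under it.  The two candidates
-- (i,f)ω⁻ and (f,j)ω⁻ each trade the arc (i, j) for a shorter one.
module ArcOverFixedPoint {n} {ω : Map n} (invω : Involution ω) {i j f : Fin n}
  (ωi : ω i ≡ j) (ωf : ω f ≡ f) (i<f : i <ᶠ f) (f<j : f <ᶠ j) where

  ωₗ ωᵣ : Map n
  ωₗ = link i f (unlink1 j ω)
  ωᵣ = link f j (unlink1 i ω)

  I J F : ℕ
  I = toℕ i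
  J = toℕ j
  F = toℕ f

  i<j : i <ᶠ j
  i<j = <-trans i<f f<j

  ωj : ω j ≡ i
  ωj = partner invω ωi

  arcs-ωₗ : ∀ lo hi → arcs ωₗ lo hi + arc lo hi I J ≡ arcs ω lo hi + arc lo hi I F
  arcs-ωₗ lo hi = begin
    arcs ωₗ lo hi + arc lo hi I J                    ≡⟨ cong (arcs ωₗ lo hi +_) (drop-zero (arc lo hi I J) (arc-refl lo hi F)) ⟨
    arcs ωₗ lo hi + (arc lo hi I J + arc lo hi F F)  ≡⟨ arcs-link ρ (<⇒≢ i<f) ρi ρf lo hi ⟩
    arcs ρ lo hi + (arc lo hi I F + arc lo hi F I)   ≡⟨ cong₂ _+_ unlink-step (drop-zero (arc lo hi I F) (arc-backward lo hi (<⇒≤ i<f))) ⟩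
    arcs ω lo hi + arc lo hi I F                     ∎
    where
    open ≡-Reasoning
    ρ = unlink1 j ω
    ρi = trans (upd-there ω j j (<⇒≢ i<j)) ωi
    ρf = trans (upd-there ω j j (<⇒≢ f<j)) ωf
    unlink-step : arcs ρ lo hi ≡ arcs ω lo hi
    unlink-step = begin
      arcs ρ lo hi                    ≡⟨ drop-zero (arcs ρ lo hi) (arc-backward lo hi (<⇒≤ i<j)) ⟨
      arcs ρ lo hi + arc lo hi J I    ≡⟨ arcs-upd ω ωj j lo hi ⟩
      arcs ω lo hi + arc lo hi J J    ≡⟨ drop-zero (arcs ω lo hi) (arc-refl lo hi J) ⟩
      arcs ω lo hi                    ∎

  arcs-ωᵣ : ∀ lo hi → arcs ωᵣ lo hi + arc lo hi I J ≡ arcs ω lo hi + arc lo hi F J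
  arcs-ωᵣ lo hi = begin
    arcs ωᵣ lo hi + arc lo hi I J              ≡⟨ cong (_+ arc lo hi I J) link-step ⟩
    arcs ρ lo hi + arc lo hi F J + arc lo hi I J ≡⟨ swap (arcs ρ lo hi) (arc lo hi F J) (arc lo hi I J) ⟩
    arcs ρ lo hi + arc lo hi I J + arc lo hi F J ≡⟨ cong (_+ arc lo hi F J) unlink-step ⟩
    arcs ω lo hi + arc lo hi F J               ∎
    where
    open ≡-Reasoning
    ρ = unlink1 i ω
    ρf = trans (upd-there ω i i (≢-sym (<⇒≢ i<f))) ωf
    ρj = trans (upd-there ω i i (≢-sym (<⇒≢ i<j))) ωj
    unlink-step : arcs ρ lo hi + arc lo hi I J ≡ arcs ω lo hi
    unlink-step = trans (arcs-upd ω ωi i lo hi) (drop-zero (arcs ω lo hi) (arc-refl lo hi I))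
    link-step : arcs ωᵣ lo hi ≡ arcs ρ lo hi + arc lo hi F J
    link-step = begin
      arcs ωᵣ lo hi                                              ≡⟨ drop-zero (arcs ωᵣ lo hi) vanishing ⟨
      arcs ωᵣ lo hi + (arc lo hi F F + arc lo hi J I)            ≡⟨ arcs-link ρ (<⇒≢ f<j) ρf ρj lo hi ⟩
      arcs ρ lo hi + (arc lo hi F J + arc lo hi J F)             ≡⟨ cong (arcs ρ lo hi +_) (drop-zero (arc lo hi F J) (arc-backward lo hi (<⇒≤ f<j))) ⟩
      arcs ρ lo hi + arc lo hi F J                               ∎
      where
      vanishing : arc lo hi F F + arc lo hi J I ≡ 0
      vanishing = cong₂ _+_ (arc-refl lo hi F) (arc-backward lo hi (<⇒≤ i<j))
    swap : ∀ a b c → a + b + c ≡ a + c + b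
    swap = solve-∀

  -- [a, b] contains the new arc (i, f) but not the old arc (i, j).
  BadL : Fin n → Fin n → Set
  BadL a b = a ≤ᶠ i × f ≤ᶠ b × b <ᶠ j

  -- [a, b] contains the new arc (f, j) but not the old arc (i, j).
  BadR : Fin n → Fin n → Set
  BadR a b = i <ᶠ a × a ≤ᶠ f × j ≤ᶠ b

  ωₗ-exceeds : ωₗ Exceeds ω OnlyOn BadL
  ωₗ-exceeds = exceeds-from-arcs arcs-ωₗ (λ a b → ≤-trans (arc≤1 (toℕ a) (suc (toℕ b)) I F) (s≤s z≤n)) only-bad
    where
    only-bad : ∀ a b → arc (toℕ a) (suc (toℕ b)) I F ≤ arc (toℕ a) (suc (toℕ b)) I J ⊎ BadL a b
    only-bad a b = arc-mono-or contains
      where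
      contains : ArcIn (toℕ a) (suc (toℕ b)) I F → ArcIn (toℕ a) (suc (toℕ b)) I J ⊎ BadL a b
      contains (_ , (a≤i , _) , (_ , f≤b)) with J <? suc (toℕ b)
      ... | yes j≤b = inj₁ (arcIn a≤i i<j j≤b)
      ... | no j≰b  = inj₂ (a≤i , s≤s⁻¹ f≤b , ≮⇒≥ j≰b)

  ωᵣ-exceeds : ωᵣ Exceeds ω OnlyOn BadR
  ωᵣ-exceeds = exceeds-from-arcs arcs-ωᵣ (λ a b → ≤-trans (arc≤1 (toℕ a) (suc (toℕ b)) F J) (s≤s z≤n)) only-bad
    where
    only-bad : ∀ a b → arc (toℕ a) (suc (toℕ b)) F J ≤ arc (toℕ a) (suc (toℕ b)) I J ⊎ BadR a b
    only-bad a b = arc-mono-or contains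
      where
      contains : ArcIn (toℕ a) (suc (toℕ b)) F J → ArcIn (toℕ a) (suc (toℕ b)) I J ⊎ BadR a b
      contains (_ , (a≤f , _) , (_ , j≤b)) with I <? toℕ a
      ... | yes i<a = inj₂ (i<a , a≤f , s≤s⁻¹ j≤b)
      ... | no i≮a  = inj₁ (arcIn (≮⇒≥ i≮a) i<j j≤b)

-- Part (b): ω has crossing arcs (i, j) and (l, m), i < l < j < m.  The candidates
-- (i,l)(j,m)ω⁻ and (i,m)(j,l)ω⁻ resolve the crossing into two side-by-side arcs,
-- resp. two nested arcs.
module CrossingArcs {n} {ω : Map n} (invω : Involution ω) {i j l m : Fin n}
  (ωi : ω i ≡ j) (ωl : ω l ≡ m) (i<l : i <ᶠ l) (l<j : l <ᶠ j) (j<m : j <ᶠ m) where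

  ωₛ ωₙ : Map n
  ωₛ = link i l (link j m ω)
  ωₙ = link i m (link j l ω)

  I J L M : ℕ
  I = toℕ i
  J = toℕ j
  L = toℕ l
  M = toℕ m

  i<j : i <ᶠ j
  i<j = <-trans i<l l<j
  i<m : i <ᶠ m
  i<m = <-trans i<j j<m
  l<m : l <ᶠ m
  l<m = <-trans l<j j<m

  ωj : ω j ≡ i
  ωj = partner invω ωi
  ωm : ω m ≡ l
  ωm = partner invω ωl

  arcs-ωₛ : ∀ lo hi → arcs ωₛ lo hi + (arc lo hi I J + arc lo hi L M) ≡ arcs ω lo hi + (arc lo hi I L + arc lo hi J M)
  arcs-ωₛ lo hi = begin
    arcs ωₛ lo hi + (arc lo hi I J + arc lo hi L M)  ≡⟨ arcs-link ρ (<⇒≢ i<l) ρi ρl lo hi ⟩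
    arcs ρ lo hi + (arc lo hi I L + arc lo hi L I)   ≡⟨ cong₂ _+_ ρ-step (drop-zero (arc lo hi I L) (arc-backward lo hi (<⇒≤ i<l))) ⟩
    arcs ω lo hi + arc lo hi J M + arc lo hi I L     ≡⟨ swap (arcs ω lo hi) (arc lo hi J M) (arc lo hi I L) ⟩
    arcs ω lo hi + (arc lo hi I L + arc lo hi J M)   ∎
    where
    open ≡-Reasoning
    ρ = link j m ω
    ρi = trans (link-there ω (<⇒≢ i<j) (<⇒≢ i<m)) ωi
    ρl = trans (link-there ω (<⇒≢ l<j) (<⇒≢ l<m)) ωl
    ρ-step : arcs ρ lo hi ≡ arcs ω lo hi + arc lo hi J M
    ρ-step = begin
      arcs ρ lo hi                                    ≡⟨ drop-zero (arcs ρ lo hi) (cong₂ _+_ (arc-backward lo hi (<⇒≤ i<j)) (arc-backward lo hi (<⇒≤ l<m))) ⟨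
      arcs ρ lo hi + (arc lo hi J I + arc lo hi M L)  ≡⟨ arcs-link ω (<⇒≢ j<m) ωj ωm lo hi ⟩
      arcs ω lo hi + (arc lo hi J M + arc lo hi M J)  ≡⟨ cong (arcs ω lo hi +_) (drop-zero (arc lo hi J M) (arc-backward lo hi (<⇒≤ j<m))) ⟩
      arcs ω lo hi + arc lo hi J M                    ∎
    swap : ∀ a b c → a + b + c ≡ a + (c + b)
    swap = solve-∀

  arcs-ωₙ : ∀ lo hi → arcs ωₙ lo hi + (arc lo hi I J + arc lo hi L M) ≡ arcs ω lo hi + (arc lo hi I M + arc lo hi L J)
  arcs-ωₙ lo hi = begin
    arcs ωₙ lo hi + (arc lo hi I J + arc lo hi L M)  ≡⟨ +-assoc (arcs ωₙ lo hi) (arc lo hi I J) (arc lo hi L M) ⟨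
    arcs ωₙ lo hi + arc lo hi I J + arc lo hi L M    ≡⟨ cong (_+ arc lo hi L M) outer-step ⟩
    arcs ρ lo hi + arc lo hi I M + arc lo hi L M     ≡⟨ swap (arcs ρ lo hi) (arc lo hi I M) (arc lo hi L M) ⟩
    arcs ρ lo hi + arc lo hi L M + arc lo hi I M     ≡⟨ cong (_+ arc lo hi I M) inner-step ⟩
    arcs ω lo hi + arc lo hi L J + arc lo hi I M     ≡⟨ swap′ (arcs ω lo hi) (arc lo hi L J) (arc lo hi I M) ⟩
    arcs ω lo hi + (arc lo hi I M + arc lo hi L J)   ∎
    where
    open ≡-Reasoning
    ρ = link j l ω
    ρi = trans (link-there ω (<⇒≢ i<j) (<⇒≢ i<l)) ωi
    ρm = trans (link-there ω (≢-sym (<⇒≢ j<m)) (≢-sym (<⇒≢ l<m))) ωm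
    inner-step : arcs ρ lo hi + arc lo hi L M ≡ arcs ω lo hi + arc lo hi L J
    inner-step = begin
      arcs ρ lo hi + arc lo hi L M                    ≡⟨ cong (λ z → arcs ρ lo hi + (z + arc lo hi L M)) (arc-backward lo hi (<⇒≤ i<j)) ⟨
      arcs ρ lo hi + (arc lo hi J I + arc lo hi L M)  ≡⟨ arcs-link ω (≢-sym (<⇒≢ l<j)) ωj ωl lo hi ⟩
      arcs ω lo hi + (arc lo hi J L + arc lo hi L J)  ≡⟨ cong (λ z → arcs ω lo hi + (z + arc lo hi L J)) (arc-backward lo hi (<⇒≤ l<j)) ⟩
      arcs ω lo hi + arc lo hi L J                    ∎
    outer-step : arcs ωₙ lo hi + arc lo hi I J ≡ arcs ρ lo hi + arc lo hi I M
    outer-step = begin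
      arcs ωₙ lo hi + arc lo hi I J                   ≡⟨ cong (arcs ωₙ lo hi +_) (drop-zero (arc lo hi I J) (arc-backward lo hi (<⇒≤ l<m))) ⟨
      arcs ωₙ lo hi + (arc lo hi I J + arc lo hi M L) ≡⟨ arcs-link ρ (<⇒≢ i<m) ρi ρm lo hi ⟩
      arcs ρ lo hi + (arc lo hi I M + arc lo hi M I)  ≡⟨ cong (arcs ρ lo hi +_) (drop-zero (arc lo hi I M) (arc-backward lo hi (<⇒≤ i<m))) ⟩
      arcs ρ lo hi + arc lo hi I M                    ∎
    swap : ∀ a b c → a + b + c ≡ a + c + b
    swap = solve-∀
    swap′ : ∀ a b c → a + b + c ≡ a + (c + b)
    swap′ = solve-∀

  -- [a, b] contains (i, l) but not (i, j), or (j, m) but not (l, m).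
  BadS : Fin n → Fin n → Set
  BadS a b = (a ≤ᶠ i × l ≤ᶠ b × b <ᶠ j) ⊎ (l <ᶠ a × a ≤ᶠ j × m ≤ᶠ b)

  -- [a, b] contains (l, j) but neither (i, j) nor (l, m).
  BadN : Fin n → Fin n → Set
  BadN a b = i <ᶠ a × a ≤ᶠ l × j ≤ᶠ b × b <ᶠ m

  -- If both new arcs lie in [a, b], so do both old ones.
  ωₛ-exceeds : ωₛ Exceeds ω OnlyOn BadS
  ωₛ-exceeds = exceeds-from-arcs arcs-ωₛ (λ a b → arc-pair-bound (both-old {toℕ a} {suc (toℕ b)})) only-bad
    where
    both-old : ∀ {lo hi} → ArcIn lo hi I L → ArcIn lo hi J M → ArcIn lo hi I J × ArcIn lo hi L M
    both-old (_ , (lo≤i , _) , _) (_ , _ , (_ , m<hi)) =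
      arcIn lo≤i i<j (<-trans j<m m<hi) , arcIn (≤-trans lo≤i (<⇒≤ i<l)) l<m m<hi
    only-bad : ∀ a b → arc (toℕ a) (suc (toℕ b)) I L + arc (toℕ a) (suc (toℕ b)) J M
                       ≤ arc (toℕ a) (suc (toℕ b)) I J + arc (toℕ a) (suc (toℕ b)) L M ⊎ BadS a b
    only-bad a b = +-mono-or (arc-mono-or shorter-left) (arc-mono-or shorter-right)
      where
      shorter-left : ArcIn (toℕ a) (suc (toℕ b)) I L → ArcIn (toℕ a) (suc (toℕ b)) I J ⊎ BadS a b
      shorter-left (_ , (a≤i , _) , (_ , l≤b)) with J <? suc (toℕ b)
      ... | yes j≤b = inj₁ (arcIn a≤i i<j j≤b)
      ... | no j≰b  = inj₂ (inj₁ (a≤i , s≤s⁻¹ l≤b , ≮⇒≥ j≰b))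
      shorter-right : ArcIn (toℕ a) (suc (toℕ b)) J M → ArcIn (toℕ a) (suc (toℕ b)) L M ⊎ BadS a b
      shorter-right (_ , (a≤j , _) , (_ , m≤b)) with toℕ a ≤? L
      ... | yes a≤l = inj₁ (arcIn a≤l l<m m≤b)
      ... | no a≰l  = inj₂ (inj₂ (≰⇒> a≰l , a≤j , s≤s⁻¹ m≤b))

  -- If both new arcs lie in [a, b], so do both old ones.
  ωₙ-exceeds : ωₙ Exceeds ω OnlyOn BadN
  ωₙ-exceeds = exceeds-from-arcs arcs-ωₙ (λ a b → arc-pair-bound (both-old {toℕ a} {suc (toℕ b)})) only-bad
    where
    both-old : ∀ {lo hi} → ArcIn lo hi I M → ArcIn lo hi L J → ArcIn lo hi I J × ArcIn lo hi L M
    both-old (_ , (lo≤i , _) , (_ , m<hi)) _ =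
      arcIn lo≤i i<j (<-trans j<m m<hi) , arcIn (≤-trans lo≤i (<⇒≤ i<l)) l<m m<hi
    only-bad : ∀ a b → arc (toℕ a) (suc (toℕ b)) I M + arc (toℕ a) (suc (toℕ b)) L J
                       ≤ arc (toℕ a) (suc (toℕ b)) I J + arc (toℕ a) (suc (toℕ b)) L M ⊎ BadN a b
    only-bad a b = by-cases (M <? suc (toℕ b))
      where
      lo hi : ℕ
      lo = toℕ a
      hi = suc (toℕ b)
      by-cases : Dec (M < hi) → arc lo hi I M + arc lo hi L J ≤ arc lo hi I J + arc lo hi L M ⊎ BadN a b
      by-cases (yes m≤b) = +-mono-or (arc-mono-or (inj₁ ∘ inner-shorter)) (arc-mono-or (inj₁ ∘ outer-shorter))
        where
        inner-shorter : ArcIn lo hi I M → ArcIn lo hi I J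
        inner-shorter (_ , (a≤i , _) , _) = arcIn a≤i i<j (<-trans j<m m≤b)
        outer-shorter : ArcIn lo hi L J → ArcIn lo hi L M
        outer-shorter (_ , (a≤l , _) , _) = arcIn a≤l l<m m≤b
      by-cases (no m≰b) = subst (λ r → arc lo hi I M + arc lo hi L J ≤ r ⊎ BadN a b) (+-comm (arc lo hi L M) (arc lo hi I J))
                            (+-mono-or (arc-mono-or impossible) (arc-mono-or inside-or-bad))
        where
        impossible : ArcIn lo hi I M → ArcIn lo hi L M ⊎ BadN a b
        impossible (_ , _ , (_ , m≤b)) = ⊥-elim (m≰b m≤b)
        inside-or-bad : ArcIn lo hi L J → ArcIn lo hi I J ⊎ BadN a b
        inside-or-bad (_ , (a≤l , _) , (_ , j≤b)) with I <? lo
        ... | yes i<a = inj₂ (i<a , a≤l , s≤s⁻¹ j≤b , ≮⇒≥ m≰b)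
        ... | no i≮a  = inj₁ (arcIn (≮⇒≥ i≮a) i<j j≤b)

proposition17 : ∀ (n k : ℕ) (σ ω : Map n) →
    InImax n k σ → InI n k ω → ω ≼ σ → ¬ (∀ x → ω x ≡ σ x) →
    (∀ (i j f : Fin n) → i <ᶠ j → ω i ≡ j → ω f ≡ f → i <ᶠ f → f <ᶠ j →
        (link i f (unlink1 j ω) ≼ σ) ⊎ (link f j (unlink1 i ω) ≼ σ))
    ×
    (∀ (i j l m : Fin n) → i <ᶠ j → ω i ≡ j → l <ᶠ m → ω l ≡ m →
        i <ᶠ l → l <ᶠ j → j <ᶠ m →
        (link i l (link j m ω) ≼ σ) ⊎ (link i m (link j l ω) ≼ σ))
proposition17 n k σ ω ((invσ , _) , non-crossing , no-fixed-under) (invω , _) ω≼σ _ = part-a , part-b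
  where
  open Straddle invσ invω non-crossing no-fixed-under ω≼σ using (no-tight-straddle)

  part-a : ∀ i j f → i <ᶠ j → ω i ≡ j → ω f ≡ f → i <ᶠ f → f <ᶠ j →
    (link i f (unlink1 j ω) ≼ σ) ⊎ (link f j (unlink1 i ω) ≼ σ)
  part-a i j f _ ωi ωf i<f f<j = one-of-two ω≼σ ωₗ-exceeds ωᵣ-exceeds exclusive
    where
    open ArcOverFixedPoint {ω = ω} invω ωi ωf i<f f<j
    -- [a, b] and [c, d] straddle the arc (i, j), and f lies in their overlap.
    exclusive : ∀ {a b c d} → BadL a b → BadR c d → R ω a b ≡ R σ a b → R ω c d ≡ R σ c d → ⊥
    exclusive {a} {b} {c} {d} (a≤i , f≤b , b<j) (i<c , c≤f , j≤d) =
      no-tight-straddle a c b d i j f ωi a≤i i<c c≤f f≤b b<j j≤d (inj₁ ωf)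

  part-b : ∀ i j l m → i <ᶠ j → ω i ≡ j → l <ᶠ m → ω l ≡ m → i <ᶠ l → l <ᶠ j → j <ᶠ m →
    (link i l (link j m ω) ≼ σ) ⊎ (link i m (link j l ω) ≼ σ)
  part-b i j l m _ ωi _ ωl i<l l<j j<m = one-of-two ω≼σ ωₛ-exceeds ωₙ-exceeds exclusive
    where
    open CrossingArcs {ω = ω} invω ωi ωl i<l l<j j<m
    -- Either [a, b] and [c, d] straddle (i, j) with l (partner m > d) in the overlap,
    -- or [c, d] and [a, b] straddle (l, m) with j (partner i < c) in the overlap.
    exclusive : ∀ {a b c d} → BadS a b → BadN c d → R ω a b ≡ R σ a b → R ω c d ≡ R σ c d → ⊥
    exclusive {a} {b} {c} {d} (inj₁ (a≤i , l≤b , b<j)) (i<c , c≤l , j≤d , d<m) tight₁ tight₂ =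
      no-tight-straddle a c b d i j l ωi a≤i i<c c≤l l≤b b<j j≤d
        (inj₂ (inj₂ (subst (λ z → d <ᶠ z) (sym ωl) d<m))) tight₁ tight₂
    exclusive {a} {b} {c} {d} (inj₂ (l<a , a≤j , m≤b)) (i<c , c≤l , j≤d , d<m) tight₁ tight₂ =
      no-tight-straddle c a d b l m j ωl c≤l l<a a≤j j≤d d<m m≤b
        (inj₂ (inj₁ (subst (λ z → z <ᶠ c) (sym ωj) i<c))) tight₂ tight₁
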